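{- Every minimum normal form that does not contain the constant $\mathrm{pcase}$ is a constant normal form.
   Context: Types: type expressions $\sigma ::= t \mid \sigma+\sigma \mid \sigma\times\sigma\mid \sigma\to\sigma\mid \mu t.\sigma\mid \mathrm{void}$ (types = closed ones), with types identified when they have the same infinite unfolding (type tree). Terms: typed $\lambda$-terms over typed variables and the constants, for all types $\sigma,\tau,\rho$: $0_{\sigma,\tau}:\sigma\to(\sigma+\tau)$, $1_{\sigma,\tau}:\tau\to(\sigma+\tau)$, $\mathrm{case}_{\sigma,\tau,\rho}:(\sigma+\tau)\to(\sigma\to\rho)\to(\tau\to\rho)\to\rho$, $\mathrm{pcase}_{\sigma,\tau,\rho}:(\sigma+\tau)\to\rho\to\rho\to\rho$, $\mathrm{pair}_{\sigma,\tau}:\sigma\to\tau\to(\sigma\times\tau)$, $\mathrm{fst}:(\sigma\times\tau)\to\sigma$, $\mathrm{snd}:(\sigma\times\tau)\to\tau$, $\Omega_\sigma:\sigma$. Reduction $\to$: $\beta$-reduction and the rules $\mathrm{case}(0x)yz\to yx$; $\mathrm{case}(1x)yz\to zx$; $\mathrm{fst}(\mathrm{pair}\,x\,y)\to x$; $\mathrm{snd}(\mathrm{pair}\,x\,y)\to y$; $\mathrm{pcase}(0x)yz\to y$; $\mathrm{pcase}(1x)yz\to z$; $\mathrm{pcase}\,x(0y)(0z)\to 0(\mathrm{pcase}\,xyz)$; $\mathrm{pcase}\,x(1y)(1z)\to 1(\mathrm{pcase}\,xyz)$; $\mathrm{pcase}\,x(\mathrm{pair}\,y_1y_2)(\mathrm{pair}\,z_1z_2)\to\mathrm{pair}(\mathrm{pcase}\,x\,y_1z_1)(\mathrm{pcase}\,x\,y_2z_2)$;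 $(\mathrm{pcase}\,xyz)w\to\mathrm{pcase}\,x(yw)(zw)$ (for a functional result type), applied in any context. A normal form is a term admitting no reduction step. Prefix order: $\preceq$ is the least relation on terms of equal type with $\Omega\preceq M$, $x\preceq x$ for variables and constants, closed under $\lambda$-abstraction and application. $[\![\cdot]\!]$ denotes the standard denotational semantics of the calculus (in prime-system domains; $\Omega$ denotes the least element $\bot$, constants denote their evident continuous functions, $\mathrm{fst}$, $\mathrm{snd}$, $\mathrm{case}$ are strict in their first argument); $[\![B]\!]=[\![A]\!]$ means equality for all environments. A normal form $A$ is a minimum normal form iff for every $B\preceq A$, $[\![B]\!]=[\![A]\!]$ implies $B=A$. A normal form $A$ is a constant normal form iff $A=\Omega$ or $A=\lambda x_1\ldots x_n.\,y\,A_1\ldots A_m$ with $n,m\ge0$, $y$ a variable or a constant not in $\{\Omega,\mathrm{pcase}\}$, each $A_i$ a constant normal form, and, if $y\in\{\mathrm{fst},\mathrm{snd},\mathrm{case}\}$ and $m\ge1$, then $A_1\neq\Omega$. -}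

module Defs where

open import Data.Nat using (ℕ; zero; suc; pred; _<ᵇ_; _≡ᵇ_; _⊔_)
open import Data.Fin using (Fin; zero; suc)
open import Data.Bool using (if_then_else_)
open import Data.List using (List; []; _∷_; map; concatMap; concat)
open import Data.List.Relation.Unary.All using (All)
open import Data.List.Relation.Unary.Any using (Any)
open import Data.List.Relation.Binary.Sublist.Propositional using (_⊆_)
open import Data.Product using (Σ; _×_; _,_)
open import Data.Sum using (_⊎_)
open import Data.Unit using (⊤)
open import Data.Empty using (⊥)
open import Relation.Nullary using (¬_)
open import Relation.Binary.PropositionalEquality using (_≡_)
open import Function.Bundles using (_⇔_)

-- Type expressions  σ ::= t | σ+σ | σ×σ | σ→σ | μt.σ | void
-- (de Bruijn type variables; Ty n = expressions with n free variables;
--  types = closed expressions Ty 0)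

infixr 7 _⇒_
infixr 8 _⊕_
infixr 9 _⊗_

data Ty (n : ℕ) : Set where
  tv   : Fin n → Ty n
  _⊕_  : Ty n → Ty n → Ty n
  _⊗_  : Ty n → Ty n → Ty n
  _⇒_  : Ty n → Ty n → Ty n
  μ    : Ty (suc n) → Ty n
  void : Ty n

Type : Set
Type = Ty 0

extR : ∀ {n m} → (Fin n → Fin m) → Fin (suc n) → Fin (suc m)
extR ρ zero    = zero
extR ρ (suc i) = suc (ρ i)

renTy : ∀ {n m} → (Fin n → Fin m) → Ty n → Ty m
renTy ρ (tv i)  = tv (ρ i)
renTy ρ (σ ⊕ τ) = renTy ρ σ ⊕ renTy ρ τ
renTy ρ (σ ⊗ τ) = renTy ρ σ ⊗ renTy ρ τ
renTy ρ (σ ⇒ τ) = renTy ρ σ ⇒ renTy ρ τ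
renTy ρ (μ σ)   = μ (renTy (extR ρ) σ)
renTy ρ void    = void

extS : ∀ {n m} → (Fin n → Ty m) → Fin (suc n) → Ty (suc m)
extS s zero    = tv zero
extS s (suc i) = renTy suc (s i)

subTy : ∀ {n m} → (Fin n → Ty m) → Ty n → Ty m
subTy s (tv i)  = s i
subTy s (σ ⊕ τ) = subTy s σ ⊕ subTy s τ
subTy s (σ ⊗ τ) = subTy s σ ⊗ subTy s τ
subTy s (σ ⇒ τ) = subTy s σ ⇒ subTy s τ
subTy s (μ σ)   = μ (subTy (extS s) σ)
subTy s void    = void

_[_]ᵗ : ∀ {n} → Ty (suc n) → Ty n → Ty n
σ [ τ ]ᵗ = subTy (λ { zero → τ ; (suc i) → tv i }) σ

unfoldμ : Ty 1 → Type
unfoldμ σ = σ [ μ σ ]ᵗ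

-- Head constructor of the infinite unfolding (type tree) of a type.
data Shape : Set where
  voidS  : Shape
  plusS  : Type → Type → Shape
  timesS : Type → Type → Shape
  arrowS : Type → Type → Shape

leadμ : ∀ {n} → Ty n → ℕ
leadμ (μ σ) = suc (leadμ σ)
leadμ _     = zero

hdF : ℕ → Type → Shape
hdF _       (σ ⊕ τ) = plusS σ τ
hdF _       (σ ⊗ τ) = timesS σ τ
hdF _       (σ ⇒ τ) = arrowS σ τ
hdF _       void    = voidS
hdF zero    (μ σ)   = voidS        -- non-contractive (e.g. μt.t): empty tree, read as void
hdF (suc k) (μ σ)   = hdF k (unfoldμ σ)

-- a contractive type reaches a constructor after at most (leadμ σ) unfoldings
hd : Type → Shape
hd σ = hdF (leadμ σ) σ

mutual
  EqD : ℕ → Type → Type → Set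
  EqD zero    σ τ = ⊤
  EqD (suc n) σ τ = EqS n (hd σ) (hd τ)

  EqS : ℕ → Shape → Shape → Set
  EqS n voidS          voidS          = ⊤
  EqS n (plusS σ₁ σ₂)  (plusS τ₁ τ₂)  = EqD n σ₁ τ₁ × EqD n σ₂ τ₂
  EqS n (timesS σ₁ σ₂) (timesS τ₁ τ₂) = EqD n σ₁ τ₁ × EqD n σ₂ τ₂
  EqS n (arrowS σ₁ σ₂) (arrowS τ₁ τ₂) = EqD n σ₁ τ₁ × EqD n σ₂ τ₂
  EqS n _              _              = ⊥

-- types are identified when they have the same infinite unfolding
infix 4 _≈ᵗ_
_≈ᵗ_ : Type → Type → Set
σ ≈ᵗ τ = ∀ n → EqD n σ τ

data Const : Set where
  c0 c1      : Type → Type → Const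
  case pcase : Type → Type → Type → Const
  pair fst snd : Type → Type → Const
  Ω          : Type → Const

constTy : Const → Type
constTy (c0 σ τ)      = σ ⇒ (σ ⊕ τ)
constTy (c1 σ τ)      = τ ⇒ (σ ⊕ τ)
constTy (case σ τ ρ)  = (σ ⊕ τ) ⇒ (σ ⇒ ρ) ⇒ (τ ⇒ ρ) ⇒ ρ
constTy (pcase σ τ ρ) = (σ ⊕ τ) ⇒ ρ ⇒ ρ ⇒ ρ
constTy (pair σ τ)    = σ ⇒ τ ⇒ (σ ⊗ τ)
constTy (fst σ τ)     = (σ ⊗ τ) ⇒ σ
constTy (snd σ τ)     = (σ ⊗ τ) ⇒ τ
constTy (Ω σ)         = σ

data ConstEq : Const → Const → Set where
  c0≅    : ∀ {σ τ σ' τ'} → σ ≈ᵗ σ' → τ ≈ᵗ τ' → ConstEq (c0 σ τ) (c0 σ' τ')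
  c1≅    : ∀ {σ τ σ' τ'} → σ ≈ᵗ σ' → τ ≈ᵗ τ' → ConstEq (c1 σ τ) (c1 σ' τ')
  case≅  : ∀ {σ τ ρ σ' τ' ρ'} → σ ≈ᵗ σ' → τ ≈ᵗ τ' → ρ ≈ᵗ ρ' →
           ConstEq (case σ τ ρ) (case σ' τ' ρ')
  pcase≅ : ∀ {σ τ ρ σ' τ' ρ'} → σ ≈ᵗ σ' → τ ≈ᵗ τ' → ρ ≈ᵗ ρ' →
           ConstEq (pcase σ τ ρ) (pcase σ' τ' ρ')
  pair≅  : ∀ {σ τ σ' τ'} → σ ≈ᵗ σ' → τ ≈ᵗ τ' → ConstEq (pair σ τ) (pair σ' τ')
  fst≅   : ∀ {σ τ σ' τ'} → σ ≈ᵗ σ' → τ ≈ᵗ τ' → ConstEq (fst σ τ) (fst σ' τ')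
  snd≅   : ∀ {σ τ σ' τ'} → σ ≈ᵗ σ' → τ ≈ᵗ τ' → ConstEq (snd σ τ) (snd σ' τ')
  Ω≅     : ∀ {σ σ'} → σ ≈ᵗ σ' → ConstEq (Ω σ) (Ω σ')

data Tm : Set where
  var : ℕ → Tm                 -- de Bruijn index
  con : Const → Tm
  lam : Type → Tm → Tm
  app : Tm → Tm → Tm

-- equality of terms (α-equivalence is built in; types identified up to ≈ᵗ)
infix 4 _≅_
data _≅_ : Tm → Tm → Set where
  var≅ : ∀ {i} → var i ≅ var i
  con≅ : ∀ {c c'} → ConstEq c c' → con c ≅ con c'
  lam≅ : ∀ {σ σ' M M'} → σ ≈ᵗ σ' → M ≅ M' → lam σ M ≅ lam σ' M'
  app≅ : ∀ {M M' N N'} → M ≅ M' → N ≅ N' → app M N ≅ app M' N'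

Ctx : Set
Ctx = List Type

data Lookup : Ctx → ℕ → Type → Set where
  here  : ∀ {Γ σ} → Lookup (σ ∷ Γ) zero σ
  there : ∀ {Γ σ τ i} → Lookup Γ i σ → Lookup (τ ∷ Γ) (suc i) σ

infix 3 _⊢_∶_
data _⊢_∶_ (Γ : Ctx) : Tm → Type → Set where
  ⊢var  : ∀ {i σ} → Lookup Γ i σ → Γ ⊢ var i ∶ σ
  ⊢con  : ∀ {c} → Γ ⊢ con c ∶ constTy c
  ⊢lam  : ∀ {σ τ M} → (σ ∷ Γ) ⊢ M ∶ τ → Γ ⊢ lam σ M ∶ σ ⇒ τ
  ⊢app  : ∀ {σ τ M N} → Γ ⊢ M ∶ σ ⇒ τ → Γ ⊢ N ∶ σ → Γ ⊢ app M N ∶ τ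
  ⊢conv : ∀ {σ τ M} → Γ ⊢ M ∶ σ → σ ≈ᵗ τ → Γ ⊢ M ∶ τ

shiftTm : ℕ → Tm → Tm
shiftTm c (var i)   = if i <ᵇ c then var i else var (suc i)
shiftTm c (con k)   = con k
shiftTm c (lam σ M) = lam σ (shiftTm (suc c) M)
shiftTm c (app M N) = app (shiftTm c M) (shiftTm c N)

substTm : ℕ → Tm → Tm → Tm
substTm j N (var i)   = if i <ᵇ j then var i else (if i ≡ᵇ j then N else var (pred i))
substTm j N (con k)   = con k
substTm j N (lam σ M) = lam σ (substTm (suc j) (shiftTm zero N) M)
substTm j N (app M P) = app (substTm j N M) (substTm j N P)

_[_]ₜ : Tm → Tm → Tm
M [ N ]ₜ = substTm zero N M

app2 : Tm → Tm → Tm → Tm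
app2 f x y = app (app f x) y

app3 : Tm → Tm → Tm → Tm → Tm
app3 f x y z = app (app (app f x) y) z

infix 3 _⟶_
data _⟶_ : Tm → Tm → Set where
  β      : ∀ {σ M N} → app (lam σ M) N ⟶ M [ N ]ₜ
  case0  : ∀ {σ τ ρ σ' τ' x y z} →
           app3 (con (case σ τ ρ)) (app (con (c0 σ' τ')) x) y z ⟶ app y x
  case1  : ∀ {σ τ ρ σ' τ' x y z} →
           app3 (con (case σ τ ρ)) (app (con (c1 σ' τ')) x) y z ⟶ app z x
  fstβ   : ∀ {σ τ σ' τ' x y} → app (con (fst σ τ)) (app2 (con (pair σ' τ')) x y) ⟶ x
  sndβ   : ∀ {σ τ σ' τ' x y} → app (con (snd σ τ)) (app2 (con (pair σ' τ')) x y) ⟶ y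
  pcase0 : ∀ {σ τ ρ σ' τ' x y z} →
           app3 (con (pcase σ τ ρ)) (app (con (c0 σ' τ')) x) y z ⟶ y
  pcase1 : ∀ {σ τ ρ σ' τ' x y z} →
           app3 (con (pcase σ τ ρ)) (app (con (c1 σ' τ')) x) y z ⟶ z
  pcase00 : ∀ {σ τ ρ ρ₁ ρ₂ ρ₁' ρ₂' x y z} →
           app3 (con (pcase σ τ ρ)) x (app (con (c0 ρ₁ ρ₂)) y) (app (con (c0 ρ₁' ρ₂')) z)
             ⟶ app (con (c0 ρ₁ ρ₂)) (app3 (con (pcase σ τ ρ₁)) x y z)
  pcase11 : ∀ {σ τ ρ ρ₁ ρ₂ ρ₁' ρ₂' x y z} →
           app3 (con (pcase σ τ ρ)) x (app (con (c1 ρ₁ ρ₂)) y) (app (con (c1 ρ₁' ρ₂')) z)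
             ⟶ app (con (c1 ρ₁ ρ₂)) (app3 (con (pcase σ τ ρ₂)) x y z)
  pcasePair : ∀ {σ τ ρ ρ₁ ρ₂ ρ₁' ρ₂' x y₁ y₂ z₁ z₂} →
           app3 (con (pcase σ τ ρ)) x (app2 (con (pair ρ₁ ρ₂)) y₁ y₂)
                                      (app2 (con (pair ρ₁' ρ₂')) z₁ z₂)
             ⟶ app2 (con (pair ρ₁ ρ₂)) (app3 (con (pcase σ τ ρ₁)) x y₁ z₁)
                                        (app3 (con (pcase σ τ ρ₂)) x y₂ z₂)
  pcaseApp : ∀ {σ τ ρ ρ₁ ρ₂ x y z w} → ρ ≈ᵗ (ρ₁ ⇒ ρ₂) →
           app (app3 (con (pcase σ τ ρ)) x y z) w
             ⟶ app3 (con (pcase σ τ ρ₂)) x (app y w) (app z w)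
  appL   : ∀ {M M' N} → M ⟶ M' → app M N ⟶ app M' N
  appR   : ∀ {M N N'} → N ⟶ N' → app M N ⟶ app M N'
  lamC   : ∀ {σ M M'} → M ⟶ M' → lam σ M ⟶ lam σ M'

NormalForm : Tm → Set
NormalForm M = ∀ N → ¬ (M ⟶ N)

-- Prefix order (typing of the smaller term is required separately)

infix 4 _⪯_
data _⪯_ : Tm → Tm → Set where
  Ω⪯   : ∀ {σ M} → con (Ω σ) ⪯ M
  var⪯ : ∀ {i} → var i ⪯ var i
  con⪯ : ∀ {c c'} → ConstEq c c' → con c ⪯ con c'
  lam⪯ : ∀ {σ σ' B A} → σ ≈ᵗ σ' → B ⪯ A → lam σ B ⪯ lam σ' A
  app⪯ : ∀ {B₁ B₂ A₁ A₂} → B₁ ⪯ A₁ → B₂ ⪯ A₂ → app B₁ B₂ ⪯ app A₁ A₂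

-- Denotational semantics via Scott information systems (tokens).
--   σ+τ : separated sum (tokens inl⋆ = "is a 0-value", inl a, …)
--   σ×τ : cartesian product (tokens fstT a, sndT b)
--   σ→τ : continuous function space (tokens X ↦ b, X a finite consistent set)
--   void: no tokens (the one-point domain {⊥})
-- Recursive types are interpreted through their type trees (hd).

data Tok : Set where
  inl⋆ inr⋆ : Tok
  inl inr   : Tok → Tok
  fstT sndT : Tok → Tok
  fun       : List Tok → Tok → Tok

mutual
  depth : Tok → ℕ
  depth inl⋆      = 1
  depth inr⋆      = 1
  depth (inl a)   = suc (depth a)
  depth (inr a)   = suc (depth a)
  depth (fstT a)  = suc (depth a)
  depth (sndT a)  = suc (depth a)
  depth (fun X b) = suc (depthL X ⊔ depth b)

  depthL : List Tok → ℕ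
  depthL []      = zero
  depthL (a ∷ X) = depth a ⊔ depthL X

data IsL : Tok → Set where
  isL⋆ : IsL inl⋆
  isL  : ∀ {a} → IsL (inl a)

data IsR : Tok → Set where
  isR⋆ : IsR inr⋆
  isR  : ∀ {a} → IsR (inr a)

data IsP : Tok → Set where
  isP₁ : ∀ {a} → IsP (fstT a)
  isP₂ : ∀ {a} → IsP (sndT a)

data IsF : Tok → Set where
  isF : ∀ {X b} → IsF (fun X b)

lefts rights fsts snds : List Tok → List Tok
lefts []            = []
lefts (inl a ∷ X)   = a ∷ lefts X
lefts (_ ∷ X)       = lefts X
rights []           = []
rights (inr a ∷ X)  = a ∷ rights X
rights (_ ∷ X)      = rights X
fsts []             = []
fsts (fstT a ∷ X)   = a ∷ fsts X
fsts (_ ∷ X)        = fsts X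
snds []             = []
snds (sndT a ∷ X)   = a ∷ snds X
snds (_ ∷ X)        = snds X

domT : Tok → List Tok
domT (fun X b) = X
domT _         = []

codT : Tok → Tok
codT (fun X b) = b
codT a         = a

-- Con' d σ X : X is a finite consistent set of tokens of σ
-- Ent' d σ X a : X ⊢ a in σ
-- (d is fuel; it suffices that d > the depth of the tokens involved)
mutual
  Con' : ℕ → Type → List Tok → Set
  Con' zero    σ []      = ⊤
  Con' zero    σ (_ ∷ _) = ⊥
  Con' (suc d) σ X       = ConS d (hd σ) X

  ConS : ℕ → Shape → List Tok → Set
  ConS d voidS          X = X ≡ []
  ConS d (plusS σ τ)    X = (All IsL X × Con' d σ (lefts X)) ⊎ (All IsR X × Con' d τ (rights X))
  ConS d (timesS σ τ)   X = All IsP X × Con' d σ (fsts X) × Con' d τ (snds X)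
  ConS d (arrowS σ τ)   F =
    All IsF F ×
    All (λ t → Con' d σ (domT t) × Con' d τ (codT t ∷ [])) F ×
    (∀ S → S ⊆ F → Con' d σ (concatMap domT S) → Con' d τ (map codT S))

mutual
  Ent' : ℕ → Type → List Tok → Tok → Set
  Ent' zero    σ X a = ⊥
  Ent' (suc d) σ X a = Con' (suc d) σ (a ∷ X) × EntS d (hd σ) X a

  EntS : ℕ → Shape → List Tok → Tok → Set
  EntS d (plusS σ τ)  X inl⋆       = Any IsL X
  EntS d (plusS σ τ)  X inr⋆       = Any IsR X
  EntS d (plusS σ τ)  X (inl a)    = Ent' d σ (lefts X) a
  EntS d (plusS σ τ)  X (inr a)    = Ent' d τ (rights X) a
  EntS d (timesS σ τ) X (fstT a)   = Ent' d σ (fsts X) a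
  EntS d (timesS σ τ) X (sndT a)   = Ent' d τ (snds X) a
  EntS d (arrowS σ τ) F (fun Y c)  =
    Σ (List Tok) λ S → S ⊆ F × All (λ t → All (Ent' d σ Y) (domT t)) S ×
                       Ent' d τ (map codT S) c
  EntS d _            X a          = ⊥

Con : Type → List Tok → Set
Con σ X = Con' (suc (depthL X)) σ X

Ent : Type → List Tok → Tok → Set
Ent σ X a = Ent' (suc (depthL (a ∷ X))) σ X a

-- domain elements = ideals (consistent, entailment-closed sets of tokens)
Pred : Set₁
Pred = Tok → Set

record IsIdeal (σ : Type) (x : Pred) : Set where
  field
    consistent : ∀ X → All x X → Con σ X
    closed     : ∀ X a → All x X → Ent σ X a → x a

Env : Set₁
Env = ℕ → Pred

extEnv : Env → Pred → Env
extEnv ρ x zero    = x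
extEnv ρ x (suc i) = ρ i

ValidEnv : Ctx → Env → Set
ValidEnv Γ ρ = ∀ {i σ} → Lookup Γ i σ → IsIdeal σ (ρ i)

inj0 inj1 : Pred → Pred
inj0 x inl⋆    = ⊤
inj0 x (inl a) = x a
inj0 x _       = ⊥
inj1 x inr⋆    = ⊤
inj1 x (inr a) = x a
inj1 x _       = ⊥

pairEl : Pred → Pred → Pred
pairEl x y (fstT a) = x a
pairEl x y (sndT b) = y b
pairEl x y _        = ⊥

⟦_⟧ᶜ : Const → Pred
⟦ c0 σ τ ⟧ᶜ (fun X b) = Con σ X × inj0 (Ent σ X) b
⟦ c1 σ τ ⟧ᶜ (fun X b) = Con τ X × inj1 (Ent τ X) b
⟦ case σ τ ρ ⟧ᶜ (fun X (fun Y (fun Z c))) =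
  Con (σ ⊕ τ) X × Con (σ ⇒ ρ) Y × Con (τ ⇒ ρ) Z ×
  ( (Ent (σ ⊕ τ) X inl⋆ ×
     Σ (List Tok) λ W → All (λ a → Ent (σ ⊕ τ) X (inl a)) W × Ent (σ ⇒ ρ) Y (fun W c))
  ⊎ (Ent (σ ⊕ τ) X inr⋆ ×
     Σ (List Tok) λ W → All (λ a → Ent (σ ⊕ τ) X (inr a)) W × Ent (τ ⇒ ρ) Z (fun W c)))
⟦ pcase σ τ ρ ⟧ᶜ (fun X (fun Y (fun Z c))) =
  Con (σ ⊕ τ) X × Con ρ Y × Con ρ Z ×
  ( (Ent (σ ⊕ τ) X inl⋆ × Ent ρ Y c)
  ⊎ (Ent (σ ⊕ τ) X inr⋆ × Ent ρ Z c)
  ⊎ (Ent ρ Y c × Ent ρ Z c) )                 -- pcase ⊥ y z = y ⊓ z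
⟦ pair σ τ ⟧ᶜ (fun X (fun Y t)) = Con σ X × Con τ Y × pairEl (Ent σ X) (Ent τ Y) t
⟦ fst σ τ ⟧ᶜ (fun X a) = Con (σ ⊗ τ) X × Ent (σ ⊗ τ) X (fstT a)
⟦ snd σ τ ⟧ᶜ (fun X b) = Con (σ ⊗ τ) X × Ent (σ ⊗ τ) X (sndT b)
⟦ _ ⟧ᶜ _ = ⊥                                    -- in particular ⟦Ω⟧ = ⊥ = ∅

⟦_⟧ : Tm → Env → Pred
⟦ var i ⟧ ρ a = ρ i a
⟦ con c ⟧ ρ a = ⟦ c ⟧ᶜ a
⟦ lam σ M ⟧ ρ (fun X b) = Con σ X × ⟦ M ⟧ (extEnv ρ (Ent σ X)) b
⟦ lam σ M ⟧ ρ _ = ⊥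
⟦ app M N ⟧ ρ b = Σ (List Tok) λ X → All (⟦ N ⟧ ρ) X × ⟦ M ⟧ ρ (fun X b)

SemEq : Ctx → Tm → Tm → Set₁
SemEq Γ B A = ∀ (ρ : Env) → ValidEnv Γ ρ → ∀ a → (⟦ B ⟧ ρ a ⇔ ⟦ A ⟧ ρ a)

MinimumNF : Ctx → Type → Tm → Set₁
MinimumNF Γ σ A =
  NormalForm A × (∀ B → Γ ⊢ B ∶ σ → B ⪯ A → SemEq Γ B A → B ≅ A)

data NoPcase : Tm → Set where
  npVar : ∀ {i} → NoPcase (var i)
  npCon : ∀ {c} → (∀ {σ τ ρ} → ¬ (c ≡ pcase σ τ ρ)) → NoPcase (con c)
  npLam : ∀ {σ M} → NoPcase M → NoPcase (lam σ M)
  npApp : ∀ {M N} → NoPcase M → NoPcase N → NoPcase (app M N)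

data Head : Tm → Set where
  hVar  : ∀ {i} → Head (var i)
  hC0   : ∀ {σ τ} → Head (con (c0 σ τ))
  hC1   : ∀ {σ τ} → Head (con (c1 σ τ))
  hCase : ∀ {σ τ ρ} → Head (con (case σ τ ρ))
  hPair : ∀ {σ τ} → Head (con (pair σ τ))
  hFst  : ∀ {σ τ} → Head (con (fst σ τ))
  hSnd  : ∀ {σ τ} → Head (con (snd σ τ))

data StrictHead : Tm → Set where
  sCase : ∀ {σ τ ρ} → StrictHead (con (case σ τ ρ))
  sFst  : ∀ {σ τ} → StrictHead (con (fst σ τ))
  sSnd  : ∀ {σ τ} → StrictHead (con (snd σ τ))

data IsΩ : Tm → Set where
  isΩ : ∀ {σ} → IsΩ (con (Ω σ))

mutual
  -- A = Ω  or  A = λx₁…xₙ. y A₁ … Aₘ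
  data ConstNF : Tm → Set where
    cnfΩ    : ∀ {σ} → ConstNF (con (Ω σ))
    cnfBody : ∀ {M} → LamSpine M → ConstNF M

  data LamSpine : Tm → Set where
    lsLam   : ∀ {σ M} → LamSpine M → LamSpine (lam σ M)
    lsSpine : ∀ {M} → Spine M → LamSpine M

  -- y A₁ … Aₘ, with A₁ ≠ Ω when y ∈ {fst, snd, case}
  data Spine : Tm → Set where
    spHead : ∀ {y} → Head y → Spine y
    spApp  : ∀ {M N} → Spine M → ConstNF N → (StrictHead M → ¬ IsΩ N) → Spine (app M N)

-- Call a typed proper prefix B ⪯ A with ⟦B⟧ = ⟦A⟧ a *shrinking* of A;
-- a minimum normal form has none.  We show, by induction on the typing
-- derivation, that every pcase-free normal form A is either a constant normal
-- form or has a shrinking.  A normal form that fails to be constant contains,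
-- at some position, one of three subterms denoting ⊥ that are not literally Ω:
--   λx.Ω,   Ω N,   and  c Ω  for a strict constant c ∈ {case, fst, snd};
-- replacing it by Ω gives a shrinking, and shrinkings propagate upwards since
-- the semantics is compositional.  (An applied λ-abstraction cannot occur:
-- it would be a β-redex.)
module Submission where

open import Defs
open import Data.List using ([]; _∷_)
open import Data.List.Relation.Unary.All as All using ([])
open import Data.List.Relation.Binary.Sublist.Propositional using ([])
open import Data.Nat using (zero; suc)
open import Data.Product using (_,_)
open import Data.Sum using (_⊎_; inj₁; inj₂)
open import Data.Unit using (tt)
open import Data.Empty using (⊥-elim)
open import Relation.Nullary using (¬_; Dec; yes; no)
open import Relation.Binary.PropositionalEquality using (refl)
open import Function.Bundles using (_⇔_; mk⇔; Equivalence)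

mutual
  EqD-refl : ∀ n σ → EqD n σ σ
  EqD-refl zero    σ = tt
  EqD-refl (suc n) σ = EqS-refl n (hd σ)

  EqS-refl : ∀ n s → EqS n s s
  EqS-refl n voidS        = tt
  EqS-refl n (plusS σ τ)  = EqD-refl n σ , EqD-refl n τ
  EqS-refl n (timesS σ τ) = EqD-refl n σ , EqD-refl n τ
  EqS-refl n (arrowS σ τ) = EqD-refl n σ , EqD-refl n τ

≈ᵗ-refl : ∀ σ → σ ≈ᵗ σ
≈ᵗ-refl σ n = EqD-refl n σ

ConstEq-refl : ∀ c → ConstEq c c
ConstEq-refl (c0 σ τ)      = c0≅ (≈ᵗ-refl σ) (≈ᵗ-refl τ)
ConstEq-refl (c1 σ τ)      = c1≅ (≈ᵗ-refl σ) (≈ᵗ-refl τ)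
ConstEq-refl (case σ τ ρ)  = case≅ (≈ᵗ-refl σ) (≈ᵗ-refl τ) (≈ᵗ-refl ρ)
ConstEq-refl (pcase σ τ ρ) = pcase≅ (≈ᵗ-refl σ) (≈ᵗ-refl τ) (≈ᵗ-refl ρ)
ConstEq-refl (pair σ τ)    = pair≅ (≈ᵗ-refl σ) (≈ᵗ-refl τ)
ConstEq-refl (fst σ τ)     = fst≅ (≈ᵗ-refl σ) (≈ᵗ-refl τ)
ConstEq-refl (snd σ τ)     = snd≅ (≈ᵗ-refl σ) (≈ᵗ-refl τ)
ConstEq-refl (Ω σ)         = Ω≅ (≈ᵗ-refl σ)

⪯-refl : ∀ M → M ⪯ M
⪯-refl (var i)   = var⪯
⪯-refl (con c)   = con⪯ (ConstEq-refl c)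
⪯-refl (lam σ M) = lam⪯ (≈ᵗ-refl σ) (⪯-refl M)
⪯-refl (app M N) = app⪯ (⪯-refl M) (⪯-refl N)

-- The empty set of tokens entails nothing, in every type: the bottom element
-- of every domain is the empty ideal.  This is what makes case/fst/snd strict.
mutual
  ∅-entails-nothing : ∀ d σ a → ¬ Ent' d σ [] a
  ∅-entails-nothing (suc d) σ a (_ , e) = ∅-entailsS-nothing d (hd σ) a e

  ∅-entailsS-nothing : ∀ d s a → ¬ EntS d s [] a
  ∅-entailsS-nothing d (plusS σ τ)  (inl a)   e = ∅-entails-nothing d σ a e
  ∅-entailsS-nothing d (plusS σ τ)  (inr a)   e = ∅-entails-nothing d τ a e
  ∅-entailsS-nothing d (timesS σ τ) (fstT a)  e = ∅-entails-nothing d σ a e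
  ∅-entailsS-nothing d (timesS σ τ) (sndT a)  e = ∅-entails-nothing d τ a e
  ∅-entailsS-nothing d (arrowS σ τ) (fun Y c) (.[] , [] , _ , e) =
    ∅-entails-nothing d τ c e

-- Denotational equality in every environment (stronger than SemEq, which
-- only quantifies over environments valid for a context).
infix 4 _≃⟦⟧_
_≃⟦⟧_ : Tm → Tm → Set₁
B ≃⟦⟧ A = ∀ ρ a → ⟦ B ⟧ ρ a ⇔ ⟦ A ⟧ ρ a

≃⟦⟧-lam : ∀ {B A} σ → B ≃⟦⟧ A → lam σ B ≃⟦⟧ lam σ A
≃⟦⟧-lam σ e ρ (fun X b) = mk⇔ (λ { (c , p) → c , Equivalence.to   (e ρ' b) p })
                               (λ { (c , p) → c , Equivalence.from (e ρ' b) p })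
  where ρ' = extEnv ρ (Ent σ X)
≃⟦⟧-lam σ e ρ inl⋆     = mk⇔ (λ ()) (λ ())
≃⟦⟧-lam σ e ρ inr⋆     = mk⇔ (λ ()) (λ ())
≃⟦⟧-lam σ e ρ (inl a)  = mk⇔ (λ ()) (λ ())
≃⟦⟧-lam σ e ρ (inr a)  = mk⇔ (λ ()) (λ ())
≃⟦⟧-lam σ e ρ (fstT a) = mk⇔ (λ ()) (λ ())
≃⟦⟧-lam σ e ρ (sndT a) = mk⇔ (λ ()) (λ ())

≃⟦⟧-appˡ : ∀ {B A} N → B ≃⟦⟧ A → app B N ≃⟦⟧ app A N
≃⟦⟧-appˡ N e ρ b =
  mk⇔ (λ { (X , args , p) → X , args , Equivalence.to   (e ρ (fun X b)) p })
      (λ { (X , args , p) → X , args , Equivalence.from (e ρ (fun X b)) p })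

≃⟦⟧-appʳ : ∀ {B A} M → B ≃⟦⟧ A → app M B ≃⟦⟧ app M A
≃⟦⟧-appʳ M e ρ b =
  mk⇔ (λ { (X , args , p) → X , All.map (Equivalence.to   (e ρ _)) args , p })
      (λ { (X , args , p) → X , All.map (Equivalence.from (e ρ _)) args , p })

DenotesBottom : Tm → Set₁
DenotesBottom A = ∀ ρ a → ¬ ⟦ A ⟧ ρ a

Ω-≃⟦⟧ : ∀ {A} τ → DenotesBottom A → con (Ω τ) ≃⟦⟧ A
Ω-≃⟦⟧ τ bot ρ a = mk⇔ (λ ()) (λ p → ⊥-elim (bot ρ a p))

lamΩ-bottom : ∀ σ τ → DenotesBottom (lam σ (con (Ω τ)))
lamΩ-bottom σ τ ρ (fun X b) (_ , ())

Ωapp-bottom : ∀ τ N → DenotesBottom (app (con (Ω τ)) N)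
Ωapp-bottom τ N ρ a (X , _ , ())

strictΩ-bottom : ∀ {M} → StrictHead M → ∀ τ → DenotesBottom (app M (con (Ω τ)))
strictΩ-bottom (sCase {σ} {τ}) _ ρ (fun Y (fun Z c)) ([] , [] , _ , _ , _ , inj₁ (e , _)) =
  ∅-entails-nothing _ (σ ⊕ τ) inl⋆ e
strictΩ-bottom (sCase {σ} {τ}) _ ρ (fun Y (fun Z c)) ([] , [] , _ , _ , _ , inj₂ (e , _)) =
  ∅-entails-nothing _ (σ ⊕ τ) inr⋆ e
strictΩ-bottom (sFst {σ} {τ}) _ ρ a ([] , [] , _ , e) = ∅-entails-nothing _ (σ ⊗ τ) (fstT a) e
strictΩ-bottom (sSnd {σ} {τ}) _ ρ a ([] , [] , _ , e) = ∅-entails-nothing _ (σ ⊗ τ) (sndT a) e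

strictHead? : ∀ M → Dec (StrictHead M)
strictHead? (con (case σ τ ρ))  = yes sCase
strictHead? (con (fst σ τ))     = yes sFst
strictHead? (con (snd σ τ))     = yes sSnd
strictHead? (con (c0 σ τ))      = no λ ()
strictHead? (con (c1 σ τ))      = no λ ()
strictHead? (con (pcase σ τ ρ)) = no λ ()
strictHead? (con (pair σ τ))    = no λ ()
strictHead? (con (Ω σ))         = no λ ()
strictHead? (var i)             = no λ ()
strictHead? (lam σ M)           = no λ ()
strictHead? (app M N)           = no λ ()

isΩ? : ∀ M → Dec (IsΩ M)
isΩ? (con (Ω σ))         = yes isΩ
isΩ? (con (c0 σ τ))      = no λ ()
isΩ? (con (c1 σ τ))      = no λ ()
isΩ? (con (case σ τ ρ))  = no λ ()
isΩ? (con (pcase σ τ ρ)) = no λ ()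
isΩ? (con (pair σ τ))    = no λ ()
isΩ? (con (fst σ τ))     = no λ ()
isΩ? (con (snd σ τ))     = no λ ()
isΩ? (var i)             = no λ ()
isΩ? (lam σ M)           = no λ ()
isΩ? (app M N)           = no λ ()

record Shrinking (Γ : Ctx) (τ : Type) (A : Tm) : Set₁ where
  constructor shrinking
  field
    smaller        : Tm
    typed          : Γ ⊢ smaller ∶ τ
    prefix         : smaller ⪯ A
    sameDenotation : smaller ≃⟦⟧ A
    proper         : ¬ (smaller ≅ A)

shrinkToΩ : ∀ {Γ A} τ → DenotesBottom A → ¬ (con (Ω τ) ≅ A) → Shrinking Γ τ A
shrinkToΩ {A = A} τ bot notΩ = shrinking (con (Ω τ)) ⊢con Ω⪯ (Ω-≃⟦⟧ {A} τ bot) notΩ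

shrink-conv : ∀ {Γ σ τ A} → Shrinking Γ σ A → σ ≈ᵗ τ → Shrinking Γ τ A
shrink-conv (shrinking B ⊢B B⪯A B≃A B≇A) σ≈τ = shrinking B (⊢conv ⊢B σ≈τ) B⪯A B≃A B≇A

shrink-lam : ∀ {Γ σ τ A} → Shrinking (σ ∷ Γ) τ A → Shrinking Γ (σ ⇒ τ) (lam σ A)
shrink-lam {σ = σ} {A = A} (shrinking B ⊢B B⪯A B≃A B≇A) =
  shrinking (lam σ B) (⊢lam ⊢B) (lam⪯ (≈ᵗ-refl σ) B⪯A) (≃⟦⟧-lam {B} {A} σ B≃A)
            λ { (lam≅ _ B≅A) → B≇A B≅A }

shrink-appˡ : ∀ {Γ σ τ M N} → Shrinking Γ (σ ⇒ τ) M → Γ ⊢ N ∶ σ → Shrinking Γ τ (app M N)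
shrink-appˡ {M = M} {N} (shrinking B ⊢B B⪯M B≃M B≇M) ⊢N =
  shrinking (app B N) (⊢app ⊢B ⊢N) (app⪯ B⪯M (⪯-refl N)) (≃⟦⟧-appˡ {B} {M} N B≃M)
            λ { (app≅ B≅M _) → B≇M B≅M }

shrink-appʳ : ∀ {Γ σ τ M N} → Γ ⊢ M ∶ σ ⇒ τ → Shrinking Γ σ N → Shrinking Γ τ (app M N)
shrink-appʳ {M = M} {N} ⊢M (shrinking B ⊢B B⪯N B≃N B≇N) =
  shrinking (app M B) (⊢app ⊢M ⊢B) (app⪯ (⪯-refl M) B⪯N) (≃⟦⟧-appʳ {B} {N} M B≃N)
            λ { (app≅ _ B≅N) → B≇N B≅N }

ConstOrShrinkable : Ctx → Type → Tm → Set₁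
ConstOrShrinkable Γ τ A = ConstNF A ⊎ Shrinking Γ τ A

constOrShrinkable-con : ∀ {Γ c} → NoPcase (con c) → ConstOrShrinkable Γ (constTy c) (con c)
constOrShrinkable-con {c = c0 σ τ}      _ = inj₁ (cnfBody (lsSpine (spHead hC0)))
constOrShrinkable-con {c = c1 σ τ}      _ = inj₁ (cnfBody (lsSpine (spHead hC1)))
constOrShrinkable-con {c = case σ τ ρ}  _ = inj₁ (cnfBody (lsSpine (spHead hCase)))
constOrShrinkable-con {c = pcase σ τ ρ} (npCon notPcase) = ⊥-elim (notPcase refl)
constOrShrinkable-con {c = pair σ τ}    _ = inj₁ (cnfBody (lsSpine (spHead hPair)))
constOrShrinkable-con {c = fst σ τ}     _ = inj₁ (cnfBody (lsSpine (spHead hFst)))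
constOrShrinkable-con {c = snd σ τ}     _ = inj₁ (cnfBody (lsSpine (spHead hSnd)))
constOrShrinkable-con {c = Ω σ}         _ = inj₁ cnfΩ

constOrShrinkable-lam : ∀ {Γ σ τ M} → ConstOrShrinkable (σ ∷ Γ) τ M →
                        ConstOrShrinkable Γ (σ ⇒ τ) (lam σ M)
constOrShrinkable-lam {σ = σ} {τ} (inj₁ (cnfΩ {τ'})) =
  inj₂ (shrinkToΩ (σ ⇒ τ) (lamΩ-bottom σ τ') λ ())
constOrShrinkable-lam (inj₁ (cnfBody body)) = inj₁ (cnfBody (lsLam body))
constOrShrinkable-lam (inj₂ shrink)         = inj₂ (shrink-lam shrink)

-- Extending a spine y A₁…Aₘ by a constant normal form N: the result is a
-- constant normal form unless y is strict, m = 0 and N = Ω, where y Ω = ⊥.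
constOrShrinkable-spine : ∀ {Γ τ M N} → Spine M → ConstNF N →
                          ConstOrShrinkable Γ τ (app M N)
constOrShrinkable-spine {τ = τ} {M} {N} spine cnfN with strictHead? M | isΩ? N
... | yes strict | yes (isΩ {τ'}) = inj₂ (shrinkToΩ τ (strictΩ-bottom strict τ') λ ())
... | yes _      | no notΩ = inj₁ (cnfBody (lsSpine (spApp spine cnfN λ _ → notΩ)))
... | no lazy    | _       = inj₁ (cnfBody (lsSpine (spApp spine cnfN λ strict → ⊥-elim (lazy strict))))

-- Application M N of normal forms: a shrinking of either side lifts; Ω N
-- shrinks to Ω; M cannot be a λ-abstraction, as app M N would be a β-redex.
constOrShrinkable-app : ∀ {Γ σ τ M N} → NormalForm (app M N) →
                        Γ ⊢ M ∶ σ ⇒ τ → Γ ⊢ N ∶ σ →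
                        ConstOrShrinkable Γ (σ ⇒ τ) M → ConstOrShrinkable Γ σ N →
                        ConstOrShrinkable Γ τ (app M N)
constOrShrinkable-app         nf ⊢M ⊢N (inj₂ shrink) _ = inj₂ (shrink-appˡ shrink ⊢N)
constOrShrinkable-app {τ = τ} {N = N} nf ⊢M ⊢N (inj₁ (cnfΩ {τ'})) _ =
  inj₂ (shrinkToΩ τ (Ωapp-bottom τ' N) λ ())
constOrShrinkable-app nf ⊢M ⊢N (inj₁ (cnfBody (lsLam _))) _ = ⊥-elim (nf _ β)
constOrShrinkable-app nf ⊢M ⊢N (inj₁ (cnfBody (lsSpine _))) (inj₂ shrink) =
  inj₂ (shrink-appʳ ⊢M shrink)
constOrShrinkable-app nf ⊢M ⊢N (inj₁ (cnfBody (lsSpine spine))) (inj₁ cnfN) =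
  constOrShrinkable-spine spine cnfN

nf-lamBody : ∀ {σ M} → NormalForm (lam σ M) → NormalForm M
nf-lamBody nf M' r = nf _ (lamC r)

nf-appFun : ∀ {M N} → NormalForm (app M N) → NormalForm M
nf-appFun nf M' r = nf _ (appL r)

nf-appArg : ∀ {M N} → NormalForm (app M N) → NormalForm N
nf-appArg nf N' r = nf _ (appR r)

constOrShrinkable : ∀ {Γ τ A} → Γ ⊢ A ∶ τ → NoPcase A → NormalForm A →
                    ConstOrShrinkable Γ τ A
constOrShrinkable (⊢var _) _ _ = inj₁ (cnfBody (lsSpine (spHead hVar)))
constOrShrinkable ⊢con noPcase _ = constOrShrinkable-con noPcase
constOrShrinkable (⊢lam ⊢M) (npLam noPcase) nf =
  constOrShrinkable-lam (constOrShrinkable ⊢M noPcase (nf-lamBody nf))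
constOrShrinkable (⊢app ⊢M ⊢N) (npApp noPcaseM noPcaseN) nf =
  constOrShrinkable-app nf ⊢M ⊢N (constOrShrinkable ⊢M noPcaseM (nf-appFun nf))
                                 (constOrShrinkable ⊢N noPcaseN (nf-appArg nf))
constOrShrinkable (⊢conv ⊢A σ≈τ) noPcase nf with constOrShrinkable ⊢A noPcase nf
... | inj₁ cnf    = inj₁ cnf
... | inj₂ shrink = inj₂ (shrink-conv shrink σ≈τ)

mainTheorem12 : (Γ : Ctx) (σ : Type) (A : Tm) → Γ ⊢ A ∶ σ → NoPcase A →
                  MinimumNF Γ σ A → ConstNF A
mainTheorem12 Γ σ A ⊢A noPcase (nf , minimal) with constOrShrinkable ⊢A noPcase nf
... | inj₁ cnf = cnf
... | inj₂ (shrinking B ⊢B B⪯A B≃A B≇A) =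
  ⊥-elim (B≇A (minimal B ⊢B B⪯A λ ρ _ → B≃A ρ))
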